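{- For every integer $n\ge 2$ and every integer $k$, the number $d_k(n)$ of divisions of a honeycomb strip of length $n$ into exactly $k$ pieces equals the coefficient of $x^ny^k$ in $$\begin{bmatrix} 1& 1 \end{bmatrix} \begin{bmatrix} 1 & 1 \\ y & 1+y \end{bmatrix}^{n-2} \begin{bmatrix} y \\ y^2 \end{bmatrix} x^n .$$
   Context: A honeycomb strip of length $n$ consists of $n$ hexagons labelled $1,\dots,n$ in which hexagon $i$ is adjacent exactly with hexagons $i\pm1$ and $i\pm2$ (when these exist); equivalently its inner dual is the graph $P_n^2$ on vertices $1,\dots,n$ with $i\sim j$ iff $1\le|i-j|\le2$. A division into $k$ pieces is a partition of the hexagons into $k$ blocks each inducing a connected subgraph of $P_n^2$. Here $x,y$ are formal variables. -}

module Defs where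

open import Data.Nat using (ℕ; zero; suc; _+_; _*_; _∸_; _<ᵇ_; _≡ᵇ_)
open import Data.Bool using (Bool; true; false; _∧_; _∨_; not; if_then_else_)
open import Data.Fin using (Fin; toℕ)
open import Data.Vec using (Vec; []; _∷_; lookup)
open import Data.List using (List; []; _∷_; map; concatMap; filter; length; replicate; _++_)
open import Data.Bool.ListAction using (all; any)
open import Data.List using () renaming (allFin to allFinL)
open import Data.Bool.Properties using (T?)

-- The honeycomb strip of length n: vertices Fin n (hexagon i+1 ↔ index i),
-- inner dual P_n^2 :  i ~ j  iff  1 ≤ |i - j| ≤ 2.

dist : ℕ → ℕ → ℕ
dist i j = (i ∸ j) + (j ∸ i)

adj : ℕ → ℕ → Bool
adj i j = (0 <ᵇ dist i j) ∧ (dist i j <ᵇ 3)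

Subset : ℕ → Set
Subset n = Fin n → Bool

grow : ∀ {n} → Subset n → Subset n → Subset n
grow {n} B S w = B w ∧ (S w ∨ any (λ u → S u ∧ adj (toℕ u) (toℕ w)) (allFinL n))

iter : ∀ {n} → ℕ → Subset n → Subset n → Subset n
iter zero    B S = S
iter (suc t) B S = iter t B (grow B S)

single : ∀ {n} → Fin n → Subset n
single u w = toℕ u ≡ᵇ toℕ w

-- vertices of B reachable from u by a walk inside B (n steps suffice)
reach : ∀ {n} → Subset n → Fin n → Subset n
reach {n} B u = iter n B (single u)

connected : ∀ {n} → Subset n → Bool
connected {n} B =
  all (λ u → all (λ w → not (B u ∧ B w) ∨ reach B u w) (allFinL n)) (allFinL n)

-- Divisions into k pieces, encoded canonically as block labellings
-- v : Vec (Fin k) n (hexagon i lies in block  lookup v i) such that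
--   * every label is used (exactly k nonempty blocks),
--   * every block is connected in P_n^2,
--   * labels are in order of first occurrence (restricted growth), so
--     each unordered partition has exactly one labelling.

lab : ∀ {n k} → Vec (Fin k) n → Fin n → ℕ
lab v i = toℕ (lookup v i)

block : ∀ {n k} → Vec (Fin k) n → Fin k → Subset n
block v j i = lab v i ≡ᵇ toℕ j

surjective : ∀ {n k} → Vec (Fin k) n → Bool
surjective {n} {k} v = all (λ j → any (λ i → block v j i) (allFinL n)) (allFinL k)

blocksConnected : ∀ {n k} → Vec (Fin k) n → Bool
blocksConnected {n} {k} v = all (λ j → connected (block v j)) (allFinL k)

canonical : ∀ {n k} → Vec (Fin k) n → Bool
canonical {n} {k} v =
  all (λ i → all (λ j →
      not (toℕ j <ᵇ lab v i)
      ∨ any (λ i' → (toℕ i' <ᵇ suc (toℕ i)) ∧ block v j i') (allFinL n))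
    (allFinL k)) (allFinL n)

isDivision : ∀ {n k} → Vec (Fin k) n → Bool
isDivision v = surjective v ∧ blocksConnected v ∧ canonical v

allVecs : ∀ (n k : ℕ) → List (Vec (Fin k) n)
allVecs zero    k = [] ∷ []
allVecs (suc n) k = concatMap (λ x → map (x ∷_) (allVecs n k)) (allFinL k)

d : ℕ → ℕ → ℕ
d k n = length (filter (λ v → T? (isDivision v)) (allVecs n k))

-- Polynomials in y with ℕ coefficients (coefficient lists, lowest first),
-- and polynomials in x,y as lists (in powers of x) of polynomials in y.

Poly : Set
Poly = List ℕ

_⊕_ : Poly → Poly → Poly
[]       ⊕ q        = q
(a ∷ p)  ⊕ []       = a ∷ p
(a ∷ p)  ⊕ (b ∷ q)  = (a + b) ∷ (p ⊕ q)

scale : ℕ → Poly → Poly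
scale c = map (c *_)

_⊗_ : Poly → Poly → Poly
[]      ⊗ q = []
(a ∷ p) ⊗ q = scale a q ⊕ (0 ∷ (p ⊗ q))

coeff : Poly → ℕ → ℕ
coeff []      k       = 0
coeff (a ∷ p) zero    = a
coeff (a ∷ p) (suc k) = coeff p k

one yP : Poly
one = 1 ∷ []
yP  = 0 ∷ 1 ∷ []

record Mat : Set where
  constructor mat
  field a b c e : Poly      -- [[a , b] , [c , e]]

_⊠_ : Mat → Mat → Mat
mat a b c e ⊠ mat a' b' c' e' =
  mat ((a ⊗ a') ⊕ (b ⊗ c')) ((a ⊗ b') ⊕ (b ⊗ e'))
      ((c ⊗ a') ⊕ (e ⊗ c')) ((c ⊗ b') ⊕ (e ⊗ e'))

idM : Mat
idM = mat one [] [] one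

_^M_ : Mat → ℕ → Mat
A ^M zero  = idM
A ^M suc m = A ⊠ (A ^M m)

T : Mat
T = mat one one yP (one ⊕ yP)

rowColPoly : ℕ → Poly
rowColPoly n with T ^M (n ∸ 2)
... | mat a b c e = ((a ⊕ c) ⊗ yP) ⊕ ((b ⊕ e) ⊗ (yP ⊗ yP))

Poly2 : Set
Poly2 = List Poly

coeff2 : Poly2 → ℕ → ℕ → ℕ
coeff2 []      m       k = 0
coeff2 (p ∷ P) zero    k = coeff p k
coeff2 (p ∷ P) (suc m) k = coeff2 P m k

timesXpow : ℕ → Poly → Poly2
timesXpow n p = replicate n [] ++ (p ∷ [])

genPoly : ℕ → Poly2
genPoly n = timesXpow n (rowColPoly n)

-- Encode a division by labelling each hexagon with the number of its block, blocks being
-- numbered in order of first appearance.  A block is connected in P_n² exactly when its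
-- consecutive hexagons are at most 2 apart, so the valid labellings are the words in which,
-- read from left to right, every hexagon either opens the next new block or joins the block
-- of one of its two left neighbours.  Split these words by whether the last two hexagons
-- share a block.  Appending a hexagon to a word of the first kind gives one of the first
-- kind (repeat the last label) or, opening a block (weight y), one of the second kind; to a
-- word of the second kind, one of the first kind (repeat the last label), of the second kind
-- (repeat the label before it) or, opening a block, of the second kind.  These transitions
-- are the columns of [[1,1],[y,1+y]], and the two words of length 2 give [y ; y²].

module Submission where

open import Defs renaming (T to transfer)
open import Data.Nat using (ℕ; zero; suc; _+_; _*_; _∸_; _≤_; _<_; z≤n; s≤s; s≤s⁻¹; _≡ᵇ_; _<ᵇ_; _≤?_; _<?_)
open import Data.Nat.Properties
open import Data.Bool using (Bool; true; false; T; not; _∧_; _∨_; if_then_else_)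
open import Data.Bool.Properties using (T?; T-∧; T-∨; ∧-zeroʳ; ∧-identityʳ)
open import Data.Bool.ListAction using (all; any)
open import Data.Unit using (tt)
open import Data.Empty using (⊥-elim)
open import Data.Product using (_×_; _,_; proj₁; proj₂; ∃-syntax)
open import Data.Sum using (_⊎_; inj₁; inj₂)
open import Data.Fin using (Fin; toℕ; fromℕ<) renaming (zero to fzero; suc to fsuc)
open import Data.Fin.Properties using (toℕ<n; toℕ-injective; toℕ-fromℕ<) renaming (any? to anyFin?)
open import Data.Vec using (Vec; []; _∷_; _∷ʳ_)
open import Data.List using (List; []; _∷_; map; concatMap; concat; filter; length; _++_) renaming (allFin to allFinL)
open import Data.List.Properties using (map-tabulate)
open import Data.List.Membership.Propositional.Properties using (∈-allFin)
open import Data.List.Relation.Unary.All as All using ()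
open import Data.List.Relation.Unary.All.Properties using (all⁺; all⁻) renaming (tabulate⁺ to All-tabulate⁺)
open import Data.List.Relation.Unary.Any using (satisfied)
open import Data.List.Relation.Unary.Any.Properties using (any⁺; any⁻) renaming (tabulate⁺ to Any-tabulate⁺)
open import Function using (Equivalence; _∘_; _∘′_; id)
open import Relation.Binary using (Tri; tri<; tri≈; tri>)
open import Relation.Binary.PropositionalEquality
open import Relation.Nullary using (¬_; yes; no)
open import Relation.Nullary.Decidable using (_×-dec_)
open import Algebra.Properties.CommutativeSemigroup +-commutativeSemigroup using (interchange)

private variable A B : Set

∧-intro : ∀ {a b} → T a → T b → T (a ∧ b)
∧-intro p q = Equivalence.from T-∧ (p , q)

∧-elim : ∀ {a b} → T (a ∧ b) → T a × T b
∧-elim = Equivalence.to T-∧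

∨-elim : ∀ {a b} → T (a ∨ b) → T a ⊎ T b
∨-elim = Equivalence.to T-∨

∨-introˡ : ∀ {a b} → T a → T (a ∨ b)
∨-introˡ p = Equivalence.from T-∨ (inj₁ p)

∨-introʳ : ∀ {a b} → T b → T (a ∨ b)
∨-introʳ p = Equivalence.from T-∨ (inj₂ p)

≡ᵇ-refl : ∀ m → T (m ≡ᵇ m)
≡ᵇ-refl m = ≡⇒≡ᵇ m m refl

T-injective : ∀ {a b} → (T a → T b) → (T b → T a) → a ≡ b
T-injective {false} {false} _ _ = refl
T-injective {false} {true}  _ g = ⊥-elim (g tt)
T-injective {true}  {false} f _ = ⊥-elim (f tt)
T-injective {true}  {true}  _ _ = refl

≡ᵇ-sym : ∀ m n → (m ≡ᵇ n) ≡ (n ≡ᵇ m)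
≡ᵇ-sym m n = T-injective (λ h → ≡⇒≡ᵇ n m (sym (≡ᵇ⇒≡ m n h)))
                         (λ h → ≡⇒≡ᵇ m n (sym (≡ᵇ⇒≡ n m h)))

all-allFin⁻ : ∀ {n} (p : Fin n → Bool) → T (all p (allFinL n)) → ∀ i → T (p i)
all-allFin⁻ {n} p h i = All.lookup (all⁺ p (allFinL n) h) (∈-allFin i)

all-allFin⁺ : ∀ {n} (p : Fin n → Bool) → (∀ i → T (p i)) → T (all p (allFinL n))
all-allFin⁺ p h = all⁻ p (All-tabulate⁺ h)

any-allFin⁻ : ∀ {n} (p : Fin n → Bool) → T (any p (allFinL n)) → ∃[ i ] T (p i)
any-allFin⁻ {n} p h = satisfied (any⁻ p (allFinL n) h)

any-allFin⁺ : ∀ {n} (p : Fin n → Bool) i → T (p i) → T (any p (allFinL n))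
any-allFin⁺ p i h = any⁺ p (Any-tabulate⁺ i h)

implies⁻ : ∀ {x y} → T (not x ∨ y) → T x → T y
implies⁻ {true} h _ = h

implies⁺ : ∀ x {y} → (T x → T y) → T (not x ∨ y)
implies⁺ true  h = h tt
implies⁺ false h = tt

𝟙 : Bool → ℕ
𝟙 true  = 1
𝟙 false = 0

𝟙-∧ : ∀ a b → 𝟙 (a ∧ b) ≡ 𝟙 a * 𝟙 b
𝟙-∧ false b = refl
𝟙-∧ true  b = sym (+-identityʳ (𝟙 b))

𝟙-T : ∀ {b} → T b → 𝟙 b ≡ 1
𝟙-T {true} _ = refl

𝟙-split : ∀ a b → 𝟙 a ≡ 𝟙 (a ∧ b) + 𝟙 (a ∧ not b)
𝟙-split false b     = refl
𝟙-split true  false = refl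
𝟙-split true  true  = refl

∑ : {A : Set} → List A → (A → ℕ) → ℕ
∑ []       g = 0
∑ (x ∷ xs) g = g x + ∑ xs g

∑-cong : ∀ (xs : List A) {g h} → g ≗ h → ∑ xs g ≡ ∑ xs h
∑-cong []       g≗h = refl
∑-cong (x ∷ xs) g≗h = cong₂ _+_ (g≗h x) (∑-cong xs g≗h)

∑-zero : ∀ (xs : List A) → ∑ xs (λ _ → 0) ≡ 0
∑-zero []       = refl
∑-zero (x ∷ xs) = ∑-zero xs

∑-+ : ∀ (xs : List A) g h → ∑ xs (λ x → g x + h x) ≡ ∑ xs g + ∑ xs h
∑-+ []       g h = refl
∑-+ (x ∷ xs) g h = trans (cong (g x + h x +_) (∑-+ xs g h)) (interchange (g x) (h x) _ _)

∑-*ˡ : ∀ (xs : List A) c g → ∑ xs (λ x → c * g x) ≡ c * ∑ xs g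
∑-*ˡ []       c g = sym (*-zeroʳ c)
∑-*ˡ (x ∷ xs) c g = trans (cong (c * g x +_) (∑-*ˡ xs c g)) (sym (*-distribˡ-+ c (g x) _))

∑-++ : ∀ (xs ys : List A) g → ∑ (xs ++ ys) g ≡ ∑ xs g + ∑ ys g
∑-++ []       ys g = refl
∑-++ (x ∷ xs) ys g = trans (cong (g x +_) (∑-++ xs ys g)) (sym (+-assoc (g x) _ _))

∑-map : ∀ (f : A → B) xs g → ∑ (map f xs) g ≡ ∑ xs (g ∘ f)
∑-map f []       g = refl
∑-map f (x ∷ xs) g = cong (g (f x) +_) (∑-map f xs g)

∑-concatMap : ∀ (f : A → List B) xs g → ∑ (concatMap f xs) g ≡ ∑ xs (λ x → ∑ (f x) g)
∑-concatMap f []       g = refl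
∑-concatMap f (x ∷ xs) g = trans (∑-++ (f x) (concat (map f xs)) g) (cong (∑ (f x) g +_) (∑-concatMap f xs g))

∑-comm : ∀ xs (ys : List B) (g : A → B → ℕ) →
  ∑ xs (λ x → ∑ ys (g x)) ≡ ∑ ys (λ y → ∑ xs (λ x → g x y))
∑-comm []       ys g = sym (∑-zero ys)
∑-comm (x ∷ xs) ys g = trans (cong (∑ ys (g x) +_) (∑-comm xs ys g)) (sym (∑-+ ys (g x) _))

length-filter : ∀ (p : A → Bool) xs → length (filter (T? ∘ p) xs) ≡ ∑ xs (𝟙 ∘ p)
length-filter p []       = refl
length-filter p (x ∷ xs) with p x
... | true  = cong suc (length-filter p xs)
... | false = length-filter p xs

∑-allFin-suc : ∀ k g → ∑ (allFinL (suc k)) g ≡ g fzero + ∑ (allFinL k) (g ∘ fsuc)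
∑-allFin-suc k g = cong (g fzero +_) (trans (cong (λ xs → ∑ xs g) (sym (map-tabulate id fsuc))) (∑-map fsuc (allFinL k) g))

∑-allFin-point : ∀ k a c → ∑ (allFinL k) (λ x → 𝟙 (toℕ x ≡ᵇ a) * c) ≡ 𝟙 (a <ᵇ k) * c
∑-allFin-point zero    a       c = refl
∑-allFin-point (suc k) zero    c =
  trans (∑-allFin-suc k (λ x → 𝟙 (toℕ x ≡ᵇ 0) * c)) (trans (cong (c + 0 +_) (∑-zero (allFinL k))) (+-identityʳ _))
∑-allFin-point (suc k) (suc a) c = trans (∑-allFin-suc k (λ x → 𝟙 (toℕ x ≡ᵇ suc a) * c)) (∑-allFin-point k a c)

∑-allVecs-∷ : ∀ n k F → ∑ (allVecs (suc n) k) F ≡ ∑ (allFinL k) (λ x → ∑ (allVecs n k) (F ∘ (x ∷_)))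
∑-allVecs-∷ n k F = trans (∑-concatMap (λ x → map (x ∷_) (allVecs n k)) (allFinL k) F)
  (∑-cong (allFinL k) (λ x → ∑-map (x ∷_) (allVecs n k) F))

∑-allVecs-∷ʳ : ∀ n k F → ∑ (allVecs (suc n) k) F ≡ ∑ (allFinL k) (λ x → ∑ (allVecs n k) (F ∘ (_∷ʳ x)))
∑-allVecs-∷ʳ zero    k F = ∑-allVecs-∷ zero k F
∑-allVecs-∷ʳ (suc n) k F = begin
    ∑ (allVecs (suc (suc n)) k) F
  ≡⟨ ∑-allVecs-∷ (suc n) k F ⟩
    ∑ (allFinL k) (λ x → ∑ (allVecs (suc n) k) (F ∘ (x ∷_)))
  ≡⟨ ∑-cong (allFinL k) (λ x → ∑-allVecs-∷ʳ n k (F ∘ (x ∷_))) ⟩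
    ∑ (allFinL k) (λ x → ∑ (allFinL k) (λ y → ∑ (allVecs n k) (λ w → F (x ∷ (w ∷ʳ y)))))
  ≡⟨ ∑-comm (allFinL k) (allFinL k) _ ⟩
    ∑ (allFinL k) (λ y → ∑ (allFinL k) (λ x → ∑ (allVecs n k) (λ w → F ((x ∷ w) ∷ʳ y))))
  ≡⟨ ∑-cong (allFinL k) (λ y → sym (∑-allVecs-∷ n k (F ∘ (_∷ʳ y)))) ⟩
    ∑ (allFinL k) (λ y → ∑ (allVecs (suc n) k) (F ∘ (_∷ʳ y))) ∎
  where open ≡-Reasoning

∑-allVecs-∷ʳ-comm : ∀ n k (F : Vec (Fin k) (suc n) → ℕ) →
  ∑ (allVecs (suc n) k) F ≡ ∑ (allVecs n k) (λ w → ∑ (allFinL k) (λ x → F (w ∷ʳ x)))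
∑-allVecs-∷ʳ-comm n k F = trans (∑-allVecs-∷ʳ n k F) (∑-comm (allFinL k) (allVecs n k) _)

-- Coefficients of the transfer-matrix polynomial

-- sequences of coefficients in y; shift is multiplication by y

infixl 6 _⊞_

_⊞_ : (ℕ → ℕ) → (ℕ → ℕ) → ℕ → ℕ
(F ⊞ G) r = F r + G r

shift : (ℕ → ℕ) → ℕ → ℕ
shift F zero    = 0
shift F (suc r) = F r

shift-cong : ∀ {F G} → F ≗ G → shift F ≗ shift G
shift-cong F≗G zero    = refl
shift-cong F≗G (suc r) = F≗G r

shift-⊞ : ∀ F G → shift (F ⊞ G) ≗ shift F ⊞ shift G
shift-⊞ F G zero    = refl
shift-⊞ F G (suc r) = refl

coeff-⊕ : ∀ p q → coeff (p ⊕ q) ≗ coeff p ⊞ coeff q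
coeff-⊕ []      q       r       = refl
coeff-⊕ (a ∷ p) []      r       = sym (+-identityʳ _)
coeff-⊕ (a ∷ p) (b ∷ q) zero    = refl
coeff-⊕ (a ∷ p) (b ∷ q) (suc r) = coeff-⊕ p q r

coeff-scale : ∀ c q r → coeff (scale c q) r ≡ c * coeff q r
coeff-scale c []      r       = sym (*-zeroʳ c)
coeff-scale c (a ∷ q) zero    = refl
coeff-scale c (a ∷ q) (suc r) = coeff-scale c q r

coeff-0∷ : ∀ p → coeff (0 ∷ p) ≗ shift (coeff p)
coeff-0∷ p zero    = refl
coeff-0∷ p (suc r) = refl

coeff-∷⊗ : ∀ c p q r → coeff ((c ∷ p) ⊗ q) r ≡ c * coeff q r + shift (coeff (p ⊗ q)) r
coeff-∷⊗ c p q r = trans (coeff-⊕ (scale c q) (0 ∷ (p ⊗ q)) r)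
  (cong₂ _+_ (coeff-scale c q r) (coeff-0∷ (p ⊗ q) r))

coeff-one⊗ : ∀ q → coeff (one ⊗ q) ≗ coeff q
coeff-one⊗ q zero    = trans (coeff-∷⊗ 1 [] q 0) (trans (+-identityʳ _) (*-identityˡ _))
coeff-one⊗ q (suc r) = trans (coeff-∷⊗ 1 [] q (suc r)) (trans (+-identityʳ _) (*-identityˡ _))

coeff-yP⊗ : ∀ q → coeff (yP ⊗ q) ≗ shift (coeff q)
coeff-yP⊗ q r = trans (coeff-∷⊗ 0 one q r) (shift-cong (coeff-one⊗ q) r)

coeff-[1+y]⊗ : ∀ q → coeff ((one ⊕ yP) ⊗ q) ≗ coeff q ⊞ shift (coeff q)
coeff-[1+y]⊗ q r = trans (coeff-∷⊗ 1 one q r) (cong₂ _+_ (*-identityˡ _) (shift-cong (coeff-one⊗ q) r))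

coeff-⊗0∷ : ∀ p q → coeff (p ⊗ (0 ∷ q)) ≗ shift (coeff (p ⊗ q))
coeff-⊗0∷ []      q zero    = refl
coeff-⊗0∷ []      q (suc r) = refl
coeff-⊗0∷ (a ∷ p) q zero    = trans (coeff-∷⊗ a p (0 ∷ q) zero) (trans (+-identityʳ _) (*-zeroʳ a))
coeff-⊗0∷ (a ∷ p) q (suc r) = begin
    coeff ((a ∷ p) ⊗ (0 ∷ q)) (suc r)        ≡⟨ coeff-∷⊗ a p (0 ∷ q) (suc r) ⟩
    a * coeff q r + coeff (p ⊗ (0 ∷ q)) r    ≡⟨ cong (a * coeff q r +_) (coeff-⊗0∷ p q r) ⟩
    a * coeff q r + shift (coeff (p ⊗ q)) r  ≡⟨ coeff-∷⊗ a p q r ⟨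
    coeff ((a ∷ p) ⊗ q) r                    ∎
  where open ≡-Reasoning

coeff-⊗one : ∀ p → coeff (p ⊗ one) ≗ coeff p
coeff-⊗one []      r       = refl
coeff-⊗one (a ∷ p) zero    = trans (coeff-∷⊗ a p one zero) (trans (+-identityʳ _) (*-identityʳ a))
coeff-⊗one (a ∷ p) (suc r) = trans (coeff-∷⊗ a p one (suc r)) (cong₂ _+_ (*-zeroʳ a) (coeff-⊗one p r))

coeff-⊗yP : ∀ p → coeff (p ⊗ yP) ≗ shift (coeff p)
coeff-⊗yP p r = trans (coeff-⊗0∷ p one r) (shift-cong (coeff-⊗one p) r)

coeff-⊗yP² : ∀ p → coeff (p ⊗ (yP ⊗ yP)) ≗ shift (shift (coeff p))
coeff-⊗yP² p r = trans (coeff-⊗0∷ p yP r) (shift-cong (coeff-⊗yP p) r)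

infix 5 y·_+y²·_

y·_+y²·_ : (ℕ → ℕ) → (ℕ → ℕ) → ℕ → ℕ
y· F +y²· G = shift F ⊞ shift (shift G)

y·+y²·-cong : ∀ {F F′ G G′} → F ≗ F′ → G ≗ G′ → y· F +y²· G ≗ y· F′ +y²· G′
y·+y²·-cong F≗F′ G≗G′ r = cong₂ _+_ (shift-cong F≗F′ r) (shift-cong (shift-cong G≗G′) r)

y·+y²·-⊞ : ∀ F G H K → y· (F ⊞ G) +y²· (H ⊞ K) ≗ (y· F +y²· H) ⊞ (y· G +y²· K)
y·+y²·-⊞ F G H K zero          = refl
y·+y²·-⊞ F G H K (suc zero)    = trans (+-identityʳ _) (cong₂ _+_ (sym (+-identityʳ (F 0))) (sym (+-identityʳ (G 0))))
y·+y²·-⊞ F G H K (suc (suc r)) = interchange (F (suc r)) (G (suc r)) (H r) (K r)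

y·+y²·-shift : ∀ F G → y· shift F +y²· shift G ≗ shift (y· F +y²· G)
y·+y²·-shift F G zero    = refl
y·+y²·-shift F G (suc r) = refl

-- the two entries of transfer^j [y ; y²]
top bottom : ℕ → ℕ → ℕ
top    j = let open Mat (transfer ^M j) in y· coeff a +y²· coeff b
bottom j = let open Mat (transfer ^M j) in y· coeff c +y²· coeff e

top-suc : ∀ j → top (suc j) ≗ top j ⊞ bottom j
top-suc j r = trans (y·+y²·-cong (entry a c) (entry b e) r) (y·+y²·-⊞ (coeff a) (coeff c) (coeff b) (coeff e) r)
  where
  open Mat (transfer ^M j)
  entry : ∀ p q → coeff ((one ⊗ p) ⊕ (one ⊗ q)) ≗ coeff p ⊞ coeff q
  entry p q s = trans (coeff-⊕ (one ⊗ p) (one ⊗ q) s) (cong₂ _+_ (coeff-one⊗ p s) (coeff-one⊗ q s))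

bottom-suc : ∀ j → bottom (suc j) ≗ shift (top j) ⊞ (bottom j ⊞ shift (bottom j))
bottom-suc j r = begin
    bottom (suc j) r
  ≡⟨ y·+y²·-cong (entry a c) (entry b e) r ⟩
    (y· shift (coeff a) ⊞ (coeff c ⊞ shift (coeff c)) +y²· shift (coeff b) ⊞ (coeff e ⊞ shift (coeff e))) r
  ≡⟨ y·+y²·-⊞ (shift (coeff a)) _ (shift (coeff b)) _ r ⟩
    (y· shift (coeff a) +y²· shift (coeff b)) r + (y· coeff c ⊞ shift (coeff c) +y²· coeff e ⊞ shift (coeff e)) r
  ≡⟨ cong₂ _+_ (y·+y²·-shift (coeff a) (coeff b) r)
               (trans (y·+y²·-⊞ (coeff c) _ (coeff e) _ r) (cong (bottom j r +_) (y·+y²·-shift (coeff c) (coeff e) r))) ⟩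
    shift (top j) r + (bottom j r + shift (bottom j) r) ∎
  where
  open ≡-Reasoning
  open Mat (transfer ^M j)
  entry : ∀ p q → coeff ((yP ⊗ p) ⊕ ((one ⊕ yP) ⊗ q)) ≗ shift (coeff p) ⊞ (coeff q ⊞ shift (coeff q))
  entry p q s = trans (coeff-⊕ (yP ⊗ p) _ s) (cong₂ _+_ (coeff-yP⊗ p s) (coeff-[1+y]⊗ q s))

coeff2-timesXpow : ∀ n p → coeff2 (timesXpow n p) n ≗ coeff p
coeff2-timesXpow zero    p k = refl
coeff2-timesXpow (suc n) p k = coeff2-timesXpow n p k

rowColPoly-unfold : ∀ j → rowColPoly (suc (suc j)) ≡
  let open Mat (transfer ^M j) in ((a ⊕ c) ⊗ yP) ⊕ ((b ⊕ e) ⊗ (yP ⊗ yP))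
rowColPoly-unfold j with transfer ^M j
... | mat a b c e = refl

coeff-genPoly : ∀ j → coeff2 (genPoly (suc (suc j))) (suc (suc j)) ≗ top j ⊞ bottom j
coeff-genPoly j k = begin
    coeff2 (genPoly (suc (suc j))) (suc (suc j)) k
  ≡⟨ coeff2-timesXpow (suc (suc j)) _ k ⟩
    coeff (rowColPoly (suc (suc j))) k
  ≡⟨ cong (λ p → coeff p k) (rowColPoly-unfold j) ⟩
    coeff (((a ⊕ c) ⊗ yP) ⊕ ((b ⊕ e) ⊗ (yP ⊗ yP))) k
  ≡⟨ trans (coeff-⊕ ((a ⊕ c) ⊗ yP) _ k) (cong₂ _+_ (coeff-⊗yP (a ⊕ c) k) (coeff-⊗yP² (b ⊕ e) k)) ⟩
    (y· coeff (a ⊕ c) +y²· coeff (b ⊕ e)) k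
  ≡⟨ y·+y²·-cong (coeff-⊕ a c) (coeff-⊕ b e) k ⟩
    (y· coeff a ⊞ coeff c +y²· coeff b ⊞ coeff e) k
  ≡⟨ y·+y²·-⊞ (coeff a) (coeff c) (coeff b) (coeff e) k ⟩
    top j k + bottom j k ∎
  where
  open ≡-Reasoning
  open Mat (transfer ^M j)

-- Left-to-right recognition of divisions

-- For an accepted labelling, fresh f i is the number of blocks met among hexagons 0 … i-1,
-- i.e. the label a new block at hexagon i receives.
fresh : (ℕ → ℕ) → ℕ → ℕ
fresh f zero    = 0
fresh f (suc i) = if f i ≡ᵇ fresh f i then suc (fresh f i) else fresh f i

allowed : (ℕ → ℕ) → ℕ → ℕ → Bool
allowed f zero          x = x ≡ᵇ 0
allowed f (suc zero)    x = (x ≡ᵇ fresh f 1) ∨ (x ≡ᵇ f 0)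
allowed f (suc (suc i)) x = (x ≡ᵇ fresh f (suc (suc i))) ∨ (x ≡ᵇ f (suc i)) ∨ (x ≡ᵇ f i)

accepted : (ℕ → ℕ) → ℕ → Bool
accepted f zero    = true
accepted f (suc i) = accepted f i ∧ allowed f i (f i)

AgreeBelow : ℕ → (ℕ → ℕ) → (ℕ → ℕ) → Set
AgreeBelow n f g = ∀ {i} → i < n → f i ≡ g i

agreeBelow-suc⁻ : ∀ {n f g} → AgreeBelow (suc n) f g → AgreeBelow n f g
agreeBelow-suc⁻ f≐g i<n = f≐g (m<n⇒m<1+n i<n)

fresh-cong : ∀ {f g} n → AgreeBelow n f g → fresh f n ≡ fresh g n
fresh-cong zero    f≐g = refl
fresh-cong (suc n) f≐g rewrite f≐g (n<1+n n) | fresh-cong n (agreeBelow-suc⁻ f≐g) = refl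

allowed-cong : ∀ {f g} n x → AgreeBelow n f g → allowed f n x ≡ allowed g n x
allowed-cong zero          x f≐g = refl
allowed-cong (suc zero)    x f≐g rewrite fresh-cong 1 f≐g | f≐g (s≤s z≤n) = refl
allowed-cong (suc (suc i)) x f≐g
  rewrite fresh-cong (suc (suc i)) f≐g | f≐g (n<1+n (suc i)) | f≐g (m<n⇒m<1+n (n<1+n i)) = refl

accepted-cong : ∀ {f g} n → AgreeBelow n f g → accepted f n ≡ accepted g n
accepted-cong zero    f≐g = refl
accepted-cong {g = g} (suc n) f≐g rewrite accepted-cong n (agreeBelow-suc⁻ f≐g) | f≐g (n<1+n n)
  | allowed-cong n (g n) (agreeBelow-suc⁻ f≐g) = refl

fresh-suc : ∀ f i → (f i ≡ fresh f i × fresh f (suc i) ≡ suc (fresh f i))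
                  ⊎ (f i ≢ fresh f i × fresh f (suc i) ≡ fresh f i)
fresh-suc f i with f i ≡ᵇ fresh f i in eq
... | true  = inj₁ (≡ᵇ⇒≡ _ _ (subst T (sym eq) tt) , refl)
... | false = inj₂ ((λ e → subst T eq (≡⇒≡ᵇ _ _ e)) , refl)

fresh-mono : ∀ f i → fresh f i ≤ fresh f (suc i)
fresh-mono f i with fresh-suc f i
... | inj₁ (_ , e) = ≤-trans (n≤1+n _) (≤-reflexive (sym e))
... | inj₂ (_ , e) = ≤-reflexive (sym e)

allowed⁻ : ∀ f n x → T (allowed f n x) → x ≡ fresh f n ⊎ ∃[ j ] (j < n × n ≤ 2 + j × x ≡ f j)
allowed⁻ f zero x h = inj₁ (≡ᵇ⇒≡ x 0 h)
allowed⁻ f (suc zero) x h with ∨-elim h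
... | inj₁ h₁ = inj₁ (≡ᵇ⇒≡ _ _ h₁)
... | inj₂ h₂ = inj₂ (0 , s≤s z≤n , s≤s z≤n , ≡ᵇ⇒≡ _ _ h₂)
allowed⁻ f (suc (suc i)) x h with ∨-elim h
... | inj₁ h₁ = inj₁ (≡ᵇ⇒≡ _ _ h₁)
... | inj₂ h₂ with ∨-elim h₂
... | inj₁ h₃ = inj₂ (suc i , n<1+n (suc i) , s≤s (s≤s (n≤1+n i)) , ≡ᵇ⇒≡ _ _ h₃)
... | inj₂ h₄ = inj₂ (i , m<n⇒m<1+n (n<1+n i) , ≤-refl , ≡ᵇ⇒≡ _ _ h₄)

allowed-fresh : ∀ f n → T (allowed f n (fresh f n))
allowed-fresh f zero          = tt
allowed-fresh f (suc zero)    = ∨-introˡ (≡ᵇ-refl (fresh f 1))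
allowed-fresh f (suc (suc i)) = ∨-introˡ (≡ᵇ-refl (fresh f (suc (suc i))))

allowed-near : ∀ f n j → j < n → n ≤ 2 + j → T (allowed f n (f j))
allowed-near f (suc zero)    zero    _     _     = ∨-introʳ {f 0 ≡ᵇ fresh f 1} (≡ᵇ-refl (f 0))
allowed-near f (suc zero)    (suc j) (s≤s ()) _
allowed-near f (suc (suc i)) j       j<n   n≤2+j with m≤n⇒m<n∨m≡n (s≤s⁻¹ j<n)
... | inj₂ refl = ∨-introʳ {f j ≡ᵇ fresh f (suc j)} (∨-introˡ (≡ᵇ-refl (f j)))
... | inj₁ j<1+i with m≤n⇒m<n∨m≡n (s≤s⁻¹ j<1+i)
...   | inj₂ refl = ∨-introʳ {f j ≡ᵇ fresh f (suc (suc j))} (∨-introʳ {f j ≡ᵇ f (suc j)} (≡ᵇ-refl (f j)))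
...   | inj₁ j<i  = ⊥-elim (<⇒≱ (s≤s (s≤s j<i)) n≤2+j)

accepted⇒<fresh : ∀ f n → T (accepted f n) → ∀ {i} → i < n → f i < fresh f n
accepted⇒<fresh f (suc n) acc {i} i<1+n with ∧-elim {accepted f n} acc | m≤n⇒m<n∨m≡n (s≤s⁻¹ i<1+n)
... | acc′ , _ | inj₁ i<n = ≤-trans (accepted⇒<fresh f n acc′ i<n) (fresh-mono f n)
... | acc′ , ok | inj₂ refl with allowed⁻ f i (f i) ok
...   | inj₂ (j , j<i , _ , e) = subst (_< fresh f (suc i)) (sym e) (≤-trans (accepted⇒<fresh f i acc′ j<i) (fresh-mono f i))
...   | inj₁ e with fresh-suc f i
...     | inj₁ (_ , e′) = subst₂ _<_ (sym e) (sym e′) (n<1+n _)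
...     | inj₂ (f≢ , _) = ⊥-elim (f≢ e)

accepted⇒attained : ∀ f n → T (accepted f n) → ∀ {j} → j < fresh f n → ∃[ i ] (i < n × f i ≡ j)
accepted⇒attained f (suc n) acc {j} j<fresh with ∧-elim {accepted f n} acc | fresh-suc f n
... | acc′ , _ | inj₂ (_ , e) with accepted⇒attained f n acc′ (subst (j <_) e j<fresh)
...   | i , i<n , fi = i , m<n⇒m<1+n i<n , fi
accepted⇒attained f (suc n) acc {j} j<fresh | acc′ , _ | inj₁ (fn , e)
  with m≤n⇒m<n∨m≡n (s≤s⁻¹ (subst (j <_) e j<fresh))
...   | inj₂ refl = n , n<1+n n , fn
...   | inj₁ j<f with accepted⇒attained f n acc′ j<f
...     | i , i<n , fi = i , m<n⇒m<1+n i<n , fi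

RestrictedGrowth : (ℕ → ℕ) → ℕ → Set
RestrictedGrowth f n = ∀ {i} → i < n → ∀ {j} → j < f i → ∃[ i′ ] (i′ ≤ i × f i′ ≡ j)

ShortGaps : (ℕ → ℕ) → ℕ → Set
ShortGaps f n = ∀ {a b} → a < b → b < n → f a ≡ f b → ∃[ c ] (a ≤ c × c < b × b ≤ 2 + c × f c ≡ f b)

accepted⇒restrictedGrowth : ∀ f n → T (accepted f n) → RestrictedGrowth f n
accepted⇒restrictedGrowth f (suc n) acc {i} i<1+n {j} j<fi with ∧-elim {accepted f n} acc | m≤n⇒m<n∨m≡n (s≤s⁻¹ i<1+n)
... | acc′ , _  | inj₁ i<n = accepted⇒restrictedGrowth f n acc′ i<n j<fi
... | acc′ , ok | inj₂ refl with allowed⁻ f i (f i) ok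
...   | inj₁ e with accepted⇒attained f i acc′ (subst (j <_) e j<fi)
...     | i′ , i′<i , fi′ = i′ , <⇒≤ i′<i , fi′
accepted⇒restrictedGrowth f (suc n) acc {i} i<1+n {j} j<fi | acc′ , ok | inj₂ refl | inj₂ (c , c<i , _ , e)
  with accepted⇒restrictedGrowth f i acc′ c<i (subst (j <_) e j<fi)
...     | i′ , i′≤c , fi′ = i′ , ≤-trans i′≤c (<⇒≤ c<i) , fi′

accepted⇒shortGaps : ∀ f n → T (accepted f n) → ShortGaps f n
accepted⇒shortGaps f (suc n) acc {a} {b} a<b b<1+n fa≡fb with ∧-elim {accepted f n} acc | m≤n⇒m<n∨m≡n (s≤s⁻¹ b<1+n)
... | acc′ , _  | inj₁ b<n = accepted⇒shortGaps f n acc′ a<b b<n fa≡fb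
... | acc′ , ok | inj₂ refl with allowed⁻ f b (f b) ok
...   | inj₁ e = ⊥-elim (<⇒≢ (accepted⇒<fresh f b acc′ a<b) (trans fa≡fb e))
...   | inj₂ (c , c<b , b≤2+c , e) with a ≤? c
...     | yes a≤c = c , a≤c , c<b , b≤2+c , sym e
...     | no  a≰c = a , ≤-refl , a<b , ≤-trans b≤2+c (s≤s (s≤s (<⇒≤ (≰⇒> a≰c)))) , fa≡fb

restrictedGrowth×shortGaps⇒accepted : ∀ f n → RestrictedGrowth f n → ShortGaps f n → T (accepted f n)
restrictedGrowth×shortGaps⇒accepted f zero    rg sg = tt
restrictedGrowth×shortGaps⇒accepted f (suc n) rg sg = ∧-intro acc (allowed-last (<-cmp (f n) (fresh f n)))
  where
  acc : T (accepted f n)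
  acc = restrictedGrowth×shortGaps⇒accepted f n (rg ∘′ m<n⇒m<1+n) (λ a<b b<n → sg a<b (m<n⇒m<1+n b<n))
  allowed-last : Tri (f n < fresh f n) (f n ≡ fresh f n) (fresh f n < f n) → T (allowed f n (f n))
  allowed-last (tri≈ _ e _) = subst (T ∘ allowed f n) (sym e) (allowed-fresh f n)
  allowed-last (tri< lt _ _) with accepted⇒attained f n acc lt
  ... | a , a<n , fa with sg a<n (n<1+n n) fa
  ...   | c , _ , c<n , n≤2+c , fc = subst (T ∘ allowed f n) fc (allowed-near f n c c<n n≤2+c)
  allowed-last (tri> _ _ gt) with rg (n<1+n n) gt
  ... | i , i≤n , fi with m≤n⇒m<n∨m≡n i≤n
  ...   | inj₁ i<n  = ⊥-elim (<⇒≢ (accepted⇒<fresh f n acc i<n) fi)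
  ...   | inj₂ refl = ⊥-elim (<⇒≢ gt (sym fi))

-- Connected subsets of P_n²

dist-≤ : ∀ {m n} → m ≤ n → dist m n ≡ n ∸ m
dist-≤ m≤n rewrite m≤n⇒m∸n≡0 m≤n = refl

dist-comm : ∀ m n → dist m n ≡ dist n m
dist-comm m n = +-comm (m ∸ n) (n ∸ m)

dist-≥ : ∀ {m n} → n ≤ m → dist m n ≡ m ∸ n
dist-≥ {m} {n} n≤m = trans (dist-comm m n) (dist-≤ n≤m)

dist-< : ∀ {m n N} → m < N → n < N → dist m n < N
dist-< {m} {n} {N} m<N n<N with ≤-total m n
... | inj₁ m≤n = subst (_< N) (sym (dist-≤ m≤n)) (≤-<-trans (m∸n≤m n m) n<N)
... | inj₂ n≤m = subst (_< N) (trans (sym (dist-≤ n≤m)) (dist-comm n m)) (≤-<-trans (m∸n≤m m n) m<N)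

adj-intro : ∀ {c w} → c < w → w ≤ 2 + c → T (adj c w)
adj-intro {c} {w} c<w w≤2+c rewrite dist-≤ (<⇒≤ c<w) =
  ∧-intro (<⇒<ᵇ (m<n⇒0<n∸m c<w)) (<⇒<ᵇ (s≤s (m≤n+o⇒m∸n≤o w c (subst (w ≤_) (+-comm 2 c) w≤2+c))))

adj-sym : ∀ u w → adj u w ≡ adj w u
adj-sym u w = cong (λ d → (0 <ᵇ d) ∧ (d <ᵇ 3)) (dist-comm u w)

adj⇒≤2+ : ∀ u w → T (adj u w) → w ≤ 2 + u
adj⇒≤2+ u w a = begin
    w                  ≤⟨ m≤n+m∸n w u ⟩
    u + (w ∸ u)        ≤⟨ +-monoʳ-≤ u (≤-trans (m≤n+m (w ∸ u) (u ∸ w)) (s≤s⁻¹ dist<3)) ⟩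
    u + 2              ≡⟨ +-comm u 2 ⟩
    2 + u              ∎
  where
  open ≤-Reasoning
  dist<3 : dist u w < 3
  dist<3 = <ᵇ⇒< _ 3 (proj₂ (∧-elim a))

module _ {n : ℕ} (B : Subset n) where

  _⊆_ : Subset n → Subset n → Set
  S ⊆ S′ = ∀ {w} → T (S w) → T (S′ w)

  iter-suc : ∀ t S → iter (suc t) B S ≡ grow B (iter t B S)
  iter-suc zero    S = refl
  iter-suc (suc t) S = iter-suc t (grow B S)

  grow-⊆ : ∀ S → grow B S ⊆ B
  grow-⊆ S h = proj₁ (∧-elim h)

  grow-⊇ : ∀ S → S ⊆ B → S ⊆ grow B S
  grow-⊇ S S⊆B {w} h = ∧-intro (S⊆B h) (∨-introˡ h)

  grow-adj : ∀ S {v w} → T (S v) → T (B w) → T (adj (toℕ v) (toℕ w)) → T (grow B S w)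
  grow-adj S {v} {w} sv bw a =
    ∧-intro bw (∨-introʳ {S w} (any-allFin⁺ (λ u → S u ∧ adj (toℕ u) (toℕ w)) v (∧-intro sv a)))

  iter-⊆ : ∀ t S → S ⊆ B → iter t B S ⊆ B
  iter-⊆ zero    S S⊆B = S⊆B
  iter-⊆ (suc t) S S⊆B = iter-⊆ t (grow B S) (grow-⊆ S)

  iter-mono : ∀ S → S ⊆ B → ∀ {t t′} → t ≤ t′ → iter t B S ⊆ iter t′ B S
  iter-mono S S⊆B {t} {t′} t≤t′ with m≤n⇒m<n∨m≡n t≤t′
  ... | inj₂ refl = λ h → h
  iter-mono S S⊆B {t} {suc t′} t≤t′ | inj₁ t<1+t′ = λ h →
    subst (λ R → T (R _)) (sym (iter-suc t′ S))
      (grow-⊇ (iter t′ B S) (iter-⊆ t′ S S⊆B) (iter-mono S S⊆B (s≤s⁻¹ t<1+t′) h))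

  iter-invariant : ∀ (P : Fin n → Set) t S → (∀ {w} → T (S w) → P w) →
    (∀ {v w} → P v → T (B w) → T (adj (toℕ v) (toℕ w)) → P w) → ∀ {w} → T (iter t B S w) → P w
  iter-invariant P zero    S base step = base
  iter-invariant P (suc t) S base step = iter-invariant P t (grow B S) grow-base step
    where
    grow-base : ∀ {w} → T (grow B S w) → P w
    grow-base {w} h with ∧-elim h
    ... | bw , h′ with ∨-elim h′
    ...   | inj₁ sw = base sw
    ...   | inj₂ h″ with any-allFin⁻ (λ u → S u ∧ adj (toℕ u) (toℕ w)) h″
    ...     | v , h‴ with ∧-elim h‴
    ...       | sv , a = step (base sv) bw a

  single-⊆ : ∀ {u} → T (B u) → single u ⊆ B
  single-⊆ {u} bu {w} h = subst (T ∘ B) (toℕ-injective (≡ᵇ⇒≡ _ _ h)) bu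

  Chained : Set
  Chained = ∀ {a b} → T (B a) → T (B b) → toℕ a < toℕ b →
    ∃[ c ] (T (B c) × toℕ a ≤ toℕ c × toℕ c < toℕ b × toℕ b ≤ 2 + toℕ c)

  connected⇒reach : T (connected B) → ∀ {a b} → T (B a) → T (B b) → T (reach B a b)
  connected⇒reach con {a} {b} ba bb =
    implies⁻ (all-allFin⁻ _ (all-allFin⁻ _ con a) b) (∧-intro ba bb)

  reach-blocked : ∀ r → (∀ {w} → T (B w) → toℕ w ≤ 2 + r → toℕ w ≤ r) →
    ∀ {a w} → toℕ a ≤ r → T (reach B a w) → toℕ w ≤ r
  reach-blocked r gap {a} a≤r = iter-invariant (λ w → toℕ w ≤ r) n (single a)
    (λ h → subst (_≤ r) (≡ᵇ⇒≡ _ _ h) a≤r)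
    (λ {v} {w} v≤r bw vw → gap bw (≤-trans (adj⇒≤2+ (toℕ v) (toℕ w) vw) (+-monoʳ-≤ 2 v≤r)))

  connected⇒chained : T (connected B) → Chained
  connected⇒chained con {a} {b} ba bb a<b with toℕ b ≤? 2 + toℕ a
  ... | yes b≤2+a = a , ba , ≤-refl , a<b , b≤2+a
  ... | no  b≰2+a = far (toℕ b ∸ 3) (∸-monoˡ-≤ 3 3+a≤b) (m+[n∸m]≡n (≤-trans (m≤m+n 3 (toℕ a)) 3+a≤b))
    where
    3+a≤b : 3 + toℕ a ≤ toℕ b
    3+a≤b = ≰⇒> b≰2+a
    far : ∀ r → toℕ a ≤ r → 3 + r ≡ toℕ b →
      ∃[ c ] (T (B c) × toℕ a ≤ toℕ c × toℕ c < toℕ b × toℕ b ≤ 2 + toℕ c)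
    far r a≤r b≡3+r with anyFin? (λ c → T? (B c) ×-dec (r <? toℕ c) ×-dec (toℕ c <? toℕ b))
    ... | yes (c , bc , r<c , c<b) =
      c , bc , ≤-trans a≤r (<⇒≤ r<c) , c<b , subst (_≤ 2 + toℕ c) b≡3+r (s≤s (s≤s r<c))
    ... | no  none = ⊥-elim (<⇒≱ (≤-trans (s≤s (m≤n+m r 2)) (≤-reflexive b≡3+r))
                                 (reach-blocked r gap a≤r (connected⇒reach con ba bb)))
      where
      gap : ∀ {w} → T (B w) → toℕ w ≤ 2 + r → toℕ w ≤ r
      gap {w} bw w≤2+r with r <? toℕ w
      ... | no  r≮w = ≮⇒≥ r≮w
      ... | yes r<w = ⊥-elim (none (w , bw , r<w , subst (toℕ w <_) b≡3+r (s≤s w≤2+r)))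

  chained⇒forward : Chained → ∀ {a b} → T (B a) → T (B b) → toℕ a < toℕ b →
    ∃[ c ] (T (B c) × toℕ a < toℕ c × toℕ c ≤ toℕ b × toℕ c ≤ 2 + toℕ a)
  chained⇒forward ch {b = b} = go (suc (toℕ b)) ≤-refl
    where
    go : ∀ m {a b} → toℕ b < m → T (B a) → T (B b) → toℕ a < toℕ b →
      ∃[ c ] (T (B c) × toℕ a < toℕ c × toℕ c ≤ toℕ b × toℕ c ≤ 2 + toℕ a)
    go (suc m) {a} {b} b<1+m ba bb a<b with ch ba bb a<b
    ... | c , bc , a≤c , c<b , b≤2+c with m≤n⇒m<n∨m≡n a≤c
    ...   | inj₂ a≡c = b , bb , a<b , ≤-refl , subst (λ x → toℕ b ≤ 2 + x) (sym a≡c) b≤2+c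
    ...   | inj₁ a<c with go m (≤-trans c<b (s≤s⁻¹ b<1+m)) ba bc a<c
    ...     | c′ , bc′ , a<c′ , c′≤c , c′≤2+a = c′ , bc′ , a<c′ , ≤-trans c′≤c (<⇒≤ c<b) , c′≤2+a

  -- Every w ∈ B is reached from u in dist u w steps, walking towards u through B: from
  -- above by Chained, from below by its mirror image chained⇒forward.
  chained⇒reach : Chained → ∀ {u w} → T (B u) → T (B w) → T (reach B u w)
  chained⇒reach ch {u} {w} bu bw =
    iter-mono (single u) (single-⊆ bu) (<⇒≤ (dist-< (toℕ<n u) (toℕ<n w)))
      (within-dist (suc (dist (toℕ u) (toℕ w))) ≤-refl bw)
    where
    D : Fin n → ℕ
    D x = dist (toℕ u) (toℕ x)
    within-dist : ∀ m {w} → D w < m → T (B w) → T (iter (D w) B (single u) w)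
    from : ∀ m {c w} → D c < D w → D w < suc m → T (B c) → T (B w) → T (adj (toℕ c) (toℕ w)) →
      T (iter (D w) B (single u) w)
    from m {c} {w} Dc<Dw Dw≤m bc bw cw =
      iter-mono (single u) (single-⊆ bu) Dc<Dw
        (subst (λ R → T (R w)) (sym (iter-suc (D c) (single u)))
          (grow-adj (iter (D c) B (single u)) (within-dist m (≤-trans Dc<Dw (s≤s⁻¹ Dw≤m)) bc) bw cw))
    within-dist (suc m) {w} Dw≤m bw with <-cmp (toℕ u) (toℕ w)
    ... | tri≈ _ u≡w _ rewrite u≡w | dist-≤ (≤-refl {toℕ w}) | n∸n≡0 (toℕ w) = ≡ᵇ-refl (toℕ w)
    ... | tri< u<w _ _ with ch bu bw u<w
    ...   | c , bc , u≤c , c<w , w≤2+c =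
      from m (subst₂ _<_ (sym (dist-≤ u≤c)) (sym (dist-≤ (<⇒≤ u<w))) (∸-monoˡ-< c<w u≤c)) Dw≤m bc bw
        (adj-intro c<w w≤2+c)
    within-dist (suc m) {w} Dw≤m bw | tri> _ _ w<u with chained⇒forward ch bw bu w<u
    ...   | c , bc , w<c , c≤u , c≤2+w =
      from m (subst₂ _<_ (sym (dist-≥ c≤u)) (sym (dist-≥ (<⇒≤ w<u))) (∸-monoʳ-< w<c c≤u)) Dw≤m bc bw
        (subst T (adj-sym (toℕ w) (toℕ c)) (adj-intro w<c c≤2+w))

  chained⇒connected : Chained → T (connected B)
  chained⇒connected ch = all-allFin⁺ _ (λ u → all-allFin⁺ _ (λ w →
    implies⁺ (B u ∧ B w) (λ h → let bu , bw = ∧-elim h in chained⇒reach ch bu bw)))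

-- junk value 0 beyond the end of the vector
labels : ∀ {n k} → Vec (Fin k) n → ℕ → ℕ
labels []      i       = 0
labels (x ∷ v) zero    = toℕ x
labels (x ∷ v) (suc i) = labels v i

lab≡labels : ∀ {n k} (v : Vec (Fin k) n) i → lab v i ≡ labels v (toℕ i)
lab≡labels (x ∷ v) fzero    = refl
lab≡labels (x ∷ v) (fsuc i) = lab≡labels v i

labels<k : ∀ {n k} (v : Vec (Fin k) n) {i} → i < n → labels v i < k
labels<k (x ∷ v) {zero}  _       = toℕ<n x
labels<k (x ∷ v) {suc i} 1+i<1+n = labels<k v (s≤s⁻¹ 1+i<1+n)

labels-∷ʳ-< : ∀ {n k} (v : Vec (Fin k) n) x {i} → i < n → labels (v ∷ʳ x) i ≡ labels v i
labels-∷ʳ-< (y ∷ v) x {zero}  _       = refl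
labels-∷ʳ-< (y ∷ v) x {suc i} 1+i<1+n = labels-∷ʳ-< v x (s≤s⁻¹ 1+i<1+n)

labels-∷ʳ-last : ∀ {n k} (v : Vec (Fin k) n) x → labels (v ∷ʳ x) n ≡ toℕ x
labels-∷ʳ-last []      x = refl
labels-∷ʳ-last (y ∷ v) x = labels-∷ʳ-last v x

acceptedWith : ∀ {n k} → ℕ → Vec (Fin k) n → Bool
acceptedWith {n} M w = accepted (labels w) n ∧ (fresh (labels w) n ≡ᵇ M)

module _ {n k : ℕ} (v : Vec (Fin k) n) where

  private
    f : ℕ → ℕ
    f = labels v

  block⇒ : ∀ {j i} → T (block v j i) → f (toℕ i) ≡ toℕ j
  block⇒ {j} {i} h = trans (sym (lab≡labels v i)) (≡ᵇ⇒≡ _ _ h)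

  ⇒block : ∀ {j i} → f (toℕ i) ≡ toℕ j → T (block v j i)
  ⇒block {j} {i} e = ≡⇒≡ᵇ _ _ (trans (lab≡labels v i) e)

  Covers : Set
  Covers = ∀ {j} → j < k → ∃[ i ] (i < n × f i ≡ j)

  surjective⇒covers : T (surjective v) → Covers
  surjective⇒covers h {j} j<k with any-allFin⁻ _ (all-allFin⁻ _ h (fromℕ< j<k))
  ... | i , hi = toℕ i , toℕ<n i , trans (block⇒ hi) (toℕ-fromℕ< j<k)

  covers⇒surjective : Covers → T (surjective v)
  covers⇒surjective cov = all-allFin⁺ _ λ j → let i , i<n , fi = cov (toℕ<n j) in
    any-allFin⁺ _ (fromℕ< i<n) (⇒block (trans (cong f (toℕ-fromℕ< i<n)) fi))

  canonical⇒restrictedGrowth : T (canonical v) → RestrictedGrowth f n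
  canonical⇒restrictedGrowth h {i} i<n {j} j<fi
    with any-allFin⁻ _ (implies⁻ (all-allFin⁻ _ (all-allFin⁻ _ h (fromℕ< i<n)) (fromℕ< j<k))
                                  (<⇒<ᵇ (subst₂ _<_ (sym (toℕ-fromℕ< j<k)) fi≡ j<fi)))
    where
    j<k = <-trans j<fi (labels<k v i<n)
    fi≡ = trans (cong f (sym (toℕ-fromℕ< i<n))) (sym (lab≡labels v (fromℕ< i<n)))
  ... | i′ , h′ with ∧-elim h′
  ...   | i′≤i , bi′ = toℕ i′ , subst (toℕ i′ ≤_) (toℕ-fromℕ< i<n) (s≤s⁻¹ (<ᵇ⇒< _ _ i′≤i)) ,
                       trans (block⇒ bi′) (toℕ-fromℕ< (<-trans j<fi (labels<k v i<n)))

  restrictedGrowth⇒canonical : RestrictedGrowth f n → T (canonical v)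
  restrictedGrowth⇒canonical rg = all-allFin⁺ _ λ i → all-allFin⁺ _ λ j →
    implies⁺ (toℕ j <ᵇ lab v i) λ j<fi →
      let i′ , i′≤i , fi′ = rg (toℕ<n i) (subst (toℕ j <_) (lab≡labels v i) (<ᵇ⇒< _ _ j<fi))
          i′<n = ≤-<-trans i′≤i (toℕ<n i)
      in any-allFin⁺ _ (fromℕ< i′<n)
           (∧-intro (<⇒<ᵇ (s≤s (subst (_≤ toℕ i) (sym (toℕ-fromℕ< i′<n)) i′≤i)))
                    (⇒block (trans (cong f (toℕ-fromℕ< i′<n)) fi′)))

  blocksConnected⇒shortGaps : T (blocksConnected v) → ShortGaps f n
  blocksConnected⇒shortGaps h {a} {b} a<b b<n fa≡fb
    with connected⇒chained (block v jᶠ) (all-allFin⁻ _ h jᶠ) {aᶠ} {bᶠ}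
           (⇒block (trans (cong f toℕaᶠ) (trans fa≡fb (sym toℕjᶠ))))
           (⇒block (trans (cong f toℕbᶠ) (sym toℕjᶠ)))
           (subst₂ _<_ (sym toℕaᶠ) (sym toℕbᶠ) a<b)
    where
    aᶠ = fromℕ< (<-trans a<b b<n)
    bᶠ = fromℕ< b<n
    jᶠ = fromℕ< (labels<k v b<n)
    toℕaᶠ = toℕ-fromℕ< (<-trans a<b b<n)
    toℕbᶠ = toℕ-fromℕ< b<n
    toℕjᶠ = toℕ-fromℕ< (labels<k v b<n)
  ... | c , bc , a≤c , c<b , b≤2+c =
    toℕ c , subst (_≤ toℕ c) (toℕ-fromℕ< (<-trans a<b b<n)) a≤c , subst (toℕ c <_) (toℕ-fromℕ< b<n) c<b ,
    subst (_≤ 2 + toℕ c) (toℕ-fromℕ< b<n) b≤2+c , trans (block⇒ bc) (toℕ-fromℕ< (labels<k v b<n))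

  shortGaps⇒blocksConnected : ShortGaps f n → T (blocksConnected v)
  shortGaps⇒blocksConnected sg = all-allFin⁺ _ λ j → chained⇒connected (block v j) (chained j)
    where
    chained : ∀ j → Chained (block v j)
    chained j {a} {b} ba bb a<b with sg a<b (toℕ<n b) (trans (block⇒ ba) (sym (block⇒ bb)))
    ... | c , a≤c , c<b , b≤2+c , fc = fromℕ< c<n , ⇒block (trans (cong f toℕC) (trans fc (block⇒ bb))) ,
          subst (toℕ a ≤_) (sym toℕC) a≤c , subst (_< toℕ b) (sym toℕC) c<b ,
          subst (λ x → toℕ b ≤ 2 + x) (sym toℕC) b≤2+c
      where
      c<n = <-trans c<b (toℕ<n b)
      toℕC = toℕ-fromℕ< c<n

  fresh≡k : T (accepted f n) → Covers → fresh f n ≡ k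
  fresh≡k acc cov with <-cmp (fresh f n) k
  ... | tri≈ _ e _ = e
  ... | tri< lt _ _ = let i , i<n , fi = cov lt in ⊥-elim (<⇒≢ (accepted⇒<fresh f n acc i<n) fi)
  ... | tri> _ _ gt = let i , i<n , fi = accepted⇒attained f n acc gt in ⊥-elim (<⇒≢ (labels<k v i<n) fi)

  isDivision≡acceptedWith : isDivision v ≡ acceptedWith k v
  isDivision≡acceptedWith = T-injective to from
    where
    to : T (isDivision v) → T (accepted f n ∧ (fresh f n ≡ᵇ k))
    to h with ∧-elim h
    ... | sur , h′ with ∧-elim h′
    ...   | con , can = ∧-intro acc (≡⇒≡ᵇ _ _ (fresh≡k acc (surjective⇒covers sur)))
      where
      acc = restrictedGrowth×shortGaps⇒accepted f n (canonical⇒restrictedGrowth can) (blocksConnected⇒shortGaps con)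
    from : T (accepted f n ∧ (fresh f n ≡ᵇ k)) → T (isDivision v)
    from h with ∧-elim h
    ... | acc , fresh≡ =
      ∧-intro (covers⇒surjective λ j<k → accepted⇒attained f n acc (subst (_ <_) (sym (≡ᵇ⇒≡ _ _ fresh≡)) j<k))
        (∧-intro (shortGaps⇒blocksConnected (accepted⇒shortGaps f n acc))
                 (restrictedGrowth⇒canonical (accepted⇒restrictedGrowth f n acc)))

-- Counting accepted labellings

lastTwoEqual : ∀ {m k} → Vec (Fin k) (suc (suc m)) → Bool
lastTwoEqual {m} w = labels w (suc m) ≡ᵇ labels w m

same differ : ∀ {m k} → ℕ → Vec (Fin k) (suc (suc m)) → ℕ
same   M w = 𝟙 (acceptedWith M w ∧ lastTwoEqual w)
differ M w = 𝟙 (acceptedWith M w ∧ not (lastTwoEqual w))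

acceptedWith-∷ʳ : ∀ {n k} M (w : Vec (Fin k) n) x → let f = labels w; F = fresh f n in
  acceptedWith M (w ∷ʳ x) ≡ (accepted f n ∧ allowed f n (toℕ x)) ∧ ((if toℕ x ≡ᵇ F then suc F else F) ≡ᵇ M)
acceptedWith-∷ʳ {n} M w x
  rewrite labels-∷ʳ-last w x | accepted-cong n (labels-∷ʳ-< w x) | allowed-cong n (toℕ x) (labels-∷ʳ-< w x)
        | fresh-cong n (labels-∷ʳ-< w x) = refl

lastTwoEqual-∷ʳ : ∀ {m k} (w : Vec (Fin k) (suc (suc m))) x → lastTwoEqual (w ∷ʳ x) ≡ (toℕ x ≡ᵇ labels w (suc m))
lastTwoEqual-∷ʳ {m} w x rewrite labels-∷ʳ-last w x | labels-∷ʳ-< w x (n<1+n (suc m)) = refl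

-- A label t is appended to a word with acceptance bit G and fresh label F; isF, isA, isB
-- say whether t is F, the last label a, or the second-to-last label b.
same-letter : ∀ G isF isA isB F M → (T G → T isA → ¬ T isF) →
  𝟙 (((G ∧ (isF ∨ isA ∨ isB)) ∧ ((if isF then suc F else F) ≡ᵇ M)) ∧ isA) ≡ 𝟙 (isA ∧ (G ∧ (F ≡ᵇ M)))
same-letter false isF  isA   isB F M _      = cong 𝟙 (sym (∧-zeroʳ isA))
same-letter true  isF  false isB F M _      = cong 𝟙 (∧-zeroʳ _)
same-letter true  true true  isB F M a≢F    = ⊥-elim (a≢F tt tt tt)
same-letter true false true  isB F M _      = cong 𝟙 (∧-identityʳ _)

differ-letter : ∀ G isF isA isB eqAB F M → (T G → T isF → ¬ T isA) → (T G → T isF → ¬ T isB) →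
  (T isB → isA ≡ eqAB) →
  𝟙 (((G ∧ (isF ∨ isA ∨ isB)) ∧ ((if isF then suc F else F) ≡ᵇ M)) ∧ not isA)
    ≡ 𝟙 (isF ∧ (G ∧ (suc F ≡ᵇ M))) + 𝟙 (isB ∧ ((G ∧ (F ≡ᵇ M)) ∧ not eqAB))
differ-letter false isF  isA   isB  eqAB F M _   _   _ = sym (cong₂ _+_ (cong 𝟙 (∧-zeroʳ isF)) (cong 𝟙 (∧-zeroʳ isB)))
differ-letter true  true true  isB  eqAB F M F≢a _   _ = ⊥-elim (F≢a tt tt tt)
differ-letter true false true  false eqAB F M _  _   _ = cong 𝟙 (∧-zeroʳ _)
differ-letter true false true  true eqAB F M _   _   b⇒ rewrite sym (b⇒ tt) =
  cong 𝟙 (trans (∧-zeroʳ _) (sym (∧-zeroʳ _)))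
differ-letter true  true false true  eqAB F M _  F≢b _ = ⊥-elim (F≢b tt tt tt)
differ-letter true  true false false eqAB F M _  _   _ = trans (cong 𝟙 (∧-identityʳ _)) (sym (+-identityʳ _))
differ-letter true false false false eqAB F M _  _   _ = refl
differ-letter true false false true eqAB F M _   _   b⇒ rewrite sym (b⇒ tt) = refl

module _ {m k : ℕ} (M : ℕ) (w : Vec (Fin k) (suc (suc m))) where

  private
    N = suc (suc m)
    f = labels w
    F = fresh f N
    a = f (suc m)
    b = f m
    G = accepted f N

    a<F : T G → a < F
    a<F acc = accepted⇒<fresh f N acc (n<1+n (suc m))

    b<F : T G → b < F
    b<F acc = accepted⇒<fresh f N acc (m<n⇒m<1+n (n<1+n m))

    ≡ᵇ-≢ : ∀ {x y z} → x < z → T (y ≡ᵇ x) → ¬ T (y ≡ᵇ z)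
    ≡ᵇ-≢ {x} {y} {z} x<z y≡x y≡z = <⇒≢ x<z (trans (sym (≡ᵇ⇒≡ y x y≡x)) (≡ᵇ⇒≡ y z y≡z))

  ∑-same-∷ʳ : ∑ (allFinL k) (λ x → same M (w ∷ʳ x)) ≡ 𝟙 (acceptedWith M w)
  ∑-same-∷ʳ = begin
      ∑ (allFinL k) (λ x → same M (w ∷ʳ x))
    ≡⟨ ∑-cong (allFinL k) (λ x → begin
         same M (w ∷ʳ x)
       ≡⟨ cong₂ (λ c e → 𝟙 (c ∧ e)) (acceptedWith-∷ʳ M w x) (lastTwoEqual-∷ʳ w x) ⟩
         _
       ≡⟨ same-letter G (toℕ x ≡ᵇ F) (toℕ x ≡ᵇ a) (toℕ x ≡ᵇ b) F M
            (λ acc → ≡ᵇ-≢ {y = toℕ x} (a<F acc)) ⟩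
         𝟙 ((toℕ x ≡ᵇ a) ∧ acceptedWith M w)
       ≡⟨ 𝟙-∧ (toℕ x ≡ᵇ a) (acceptedWith M w) ⟩
         𝟙 (toℕ x ≡ᵇ a) * 𝟙 (acceptedWith M w) ∎) ⟩
      ∑ (allFinL k) (λ x → 𝟙 (toℕ x ≡ᵇ a) * 𝟙 (acceptedWith M w))
    ≡⟨ ∑-allFin-point k a (𝟙 (acceptedWith M w)) ⟩
      𝟙 (a <ᵇ k) * 𝟙 (acceptedWith M w)
    ≡⟨ cong (_* 𝟙 (acceptedWith M w)) (𝟙-T (<⇒<ᵇ (labels<k w (n<1+n (suc m))))) ⟩
      1 * 𝟙 (acceptedWith M w)
    ≡⟨ *-identityˡ _ ⟩
      𝟙 (acceptedWith M w) ∎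
    where open ≡-Reasoning

  ∑-differ-∷ʳ : ∑ (allFinL k) (λ x → differ M (w ∷ʳ x)) ≡ 𝟙 (F <ᵇ k) * 𝟙 (G ∧ (suc F ≡ᵇ M)) + differ M w
  ∑-differ-∷ʳ = begin
      ∑ (allFinL k) (λ x → differ M (w ∷ʳ x))
    ≡⟨ ∑-cong (allFinL k) (λ x → begin
         differ M (w ∷ʳ x)
       ≡⟨ cong₂ (λ c e → 𝟙 (c ∧ not e)) (acceptedWith-∷ʳ M w x) (lastTwoEqual-∷ʳ w x) ⟩
         _
       ≡⟨ differ-letter G (toℕ x ≡ᵇ F) (toℕ x ≡ᵇ a) (toℕ x ≡ᵇ b) (lastTwoEqual w) F M
            (λ acc isF isA → ≡ᵇ-≢ {y = toℕ x} (a<F acc) isA isF)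
            (λ acc isF isB → ≡ᵇ-≢ {y = toℕ x} (b<F acc) isB isF)
            (λ isB → subst (λ y → (y ≡ᵇ a) ≡ lastTwoEqual w) (sym (≡ᵇ⇒≡ (toℕ x) b isB)) (≡ᵇ-sym b a)) ⟩
         𝟙 ((toℕ x ≡ᵇ F) ∧ (G ∧ (suc F ≡ᵇ M))) + 𝟙 ((toℕ x ≡ᵇ b) ∧ (acceptedWith M w ∧ not (lastTwoEqual w)))
       ≡⟨ cong₂ _+_ (𝟙-∧ (toℕ x ≡ᵇ F) _) (𝟙-∧ (toℕ x ≡ᵇ b) _) ⟩
         𝟙 (toℕ x ≡ᵇ F) * 𝟙 (G ∧ (suc F ≡ᵇ M)) + 𝟙 (toℕ x ≡ᵇ b) * differ M w ∎) ⟩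
      ∑ (allFinL k) (λ x → 𝟙 (toℕ x ≡ᵇ F) * 𝟙 (G ∧ (suc F ≡ᵇ M)) + 𝟙 (toℕ x ≡ᵇ b) * differ M w)
    ≡⟨ ∑-+ (allFinL k) _ _ ⟩
      ∑ (allFinL k) (λ x → 𝟙 (toℕ x ≡ᵇ F) * 𝟙 (G ∧ (suc F ≡ᵇ M)))
        + ∑ (allFinL k) (λ x → 𝟙 (toℕ x ≡ᵇ b) * differ M w)
    ≡⟨ cong₂ _+_ (∑-allFin-point k F _) (∑-allFin-point k b (differ M w)) ⟩
      𝟙 (F <ᵇ k) * 𝟙 (G ∧ (suc F ≡ᵇ M)) + 𝟙 (b <ᵇ k) * differ M w
    ≡⟨ cong (λ c → 𝟙 (F <ᵇ k) * 𝟙 (G ∧ (suc F ≡ᵇ M)) + c * differ M w)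
            (𝟙-T (<⇒<ᵇ (labels<k w (m<n⇒m<1+n (n<1+n m))))) ⟩
      𝟙 (F <ᵇ k) * 𝟙 (G ∧ (suc F ≡ᵇ M)) + 1 * differ M w
    ≡⟨ cong (𝟙 (F <ᵇ k) * 𝟙 (G ∧ (suc F ≡ᵇ M)) +_) (*-identityˡ _) ⟩
      𝟙 (F <ᵇ k) * 𝟙 (G ∧ (suc F ≡ᵇ M)) + differ M w ∎
    where open ≡-Reasoning

countSame countDiffer : ℕ → ℕ → ℕ → ℕ
countSame   k m M = ∑ (allVecs (suc (suc m)) k) (same M)
countDiffer k m M = ∑ (allVecs (suc (suc m)) k) (differ M)

∑-acceptedWith : ∀ k m M →
  ∑ (allVecs (suc (suc m)) k) (𝟙 ∘ acceptedWith M) ≡ countSame k m M + countDiffer k m M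
∑-acceptedWith k m M = trans (∑-cong (allVecs (suc (suc m)) k) (λ w → 𝟙-split (acceptedWith M w) (lastTwoEqual w)))
                             (∑-+ (allVecs (suc (suc m)) k) (same M) (differ M))

countSame-suc : ∀ k m M → countSame k (suc m) M ≡ countSame k m M + countDiffer k m M
countSame-suc k m M = begin
    countSame k (suc m) M
  ≡⟨ ∑-allVecs-∷ʳ-comm (suc (suc m)) k (same M) ⟩
    ∑ (allVecs (suc (suc m)) k) (λ w → ∑ (allFinL k) (λ x → same M (w ∷ʳ x)))
  ≡⟨ ∑-cong (allVecs (suc (suc m)) k) (∑-same-∷ʳ M) ⟩
    ∑ (allVecs (suc (suc m)) k) (𝟙 ∘ acceptedWith M)
  ≡⟨ ∑-acceptedWith k m M ⟩
    countSame k m M + countDiffer k m M ∎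
  where open ≡-Reasoning

freshExtensions : ∀ {n k} → ℕ → Vec (Fin k) n → ℕ
freshExtensions {n} {k} M w = let f = labels w in 𝟙 (fresh f n <ᵇ k) * 𝟙 (accepted f n ∧ (suc (fresh f n) ≡ᵇ M))

countDiffer-suc : ∀ k m M →
  countDiffer k (suc m) M ≡ ∑ (allVecs (suc (suc m)) k) (freshExtensions M) + countDiffer k m M
countDiffer-suc k m M = begin
    countDiffer k (suc m) M
  ≡⟨ ∑-allVecs-∷ʳ-comm (suc (suc m)) k (differ M) ⟩
    ∑ (allVecs (suc (suc m)) k) (λ w → ∑ (allFinL k) (λ x → differ M (w ∷ʳ x)))
  ≡⟨ ∑-cong (allVecs (suc (suc m)) k) (∑-differ-∷ʳ M) ⟩
    ∑ (allVecs (suc (suc m)) k) (λ w → freshExtensions M w + differ M w)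
  ≡⟨ ∑-+ (allVecs (suc (suc m)) k) (freshExtensions M) (differ M) ⟩
    ∑ (allVecs (suc (suc m)) k) (freshExtensions M) + countDiffer k m M ∎
  where open ≡-Reasoning

countDiffer-suc-zero : ∀ k m → countDiffer k (suc m) 0 ≡ countDiffer k m 0
countDiffer-suc-zero k m = trans (countDiffer-suc k m 0) (cong (_+ countDiffer k m 0)
  (trans (∑-cong (allVecs (suc (suc m)) k) freshExtensions-zero) (∑-zero (allVecs (suc (suc m)) k))))
  where
  freshExtensions-zero : (w : Vec (Fin k) (suc (suc m))) → freshExtensions 0 w ≡ 0
  freshExtensions-zero w = trans (cong (𝟙 (F <ᵇ k) *_) (cong 𝟙 (∧-zeroʳ _))) (*-zeroʳ (𝟙 (F <ᵇ k)))
    where F = fresh (labels w) (suc (suc m))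

countDiffer-suc-suc : ∀ k m M → M < k →
  countDiffer k (suc m) (suc M) ≡ countSame k m M + (countDiffer k m (suc M) + countDiffer k m M)
countDiffer-suc-suc k m M M<k = begin
    countDiffer k (suc m) (suc M)
  ≡⟨ countDiffer-suc k m (suc M) ⟩
    ∑ (allVecs (suc (suc m)) k) (freshExtensions (suc M)) + countDiffer k m (suc M)
  ≡⟨ cong (_+ countDiffer k m (suc M)) (trans (∑-cong (allVecs (suc (suc m)) k) room) (∑-acceptedWith k m M)) ⟩
    (countSame k m M + countDiffer k m M) + countDiffer k m (suc M)
  ≡⟨ +-assoc (countSame k m M) _ _ ⟩
    countSame k m M + (countDiffer k m M + countDiffer k m (suc M))
  ≡⟨ cong (countSame k m M +_) (+-comm (countDiffer k m M) _) ⟩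
    countSame k m M + (countDiffer k m (suc M) + countDiffer k m M) ∎
  where
  open ≡-Reasoning
  -- a word with M < k blocks always leaves room for one more
  room : (w : Vec (Fin k) (suc (suc m))) → freshExtensions (suc M) w ≡ 𝟙 (acceptedWith M w)
  room w = trans (sym (𝟙-∧ (F <ᵇ k) _)) (cong 𝟙 (T-injective (λ h → proj₂ (∧-elim {F <ᵇ k} h)) guard))
    where
    F = fresh (labels w) (suc (suc m))
    guard : T (acceptedWith M w) → T ((F <ᵇ k) ∧ acceptedWith M w)
    guard h = ∧-intro (<⇒<ᵇ (subst (_< k) (sym F≡M) M<k)) h
      where F≡M = ≡ᵇ⇒≡ F M (proj₂ (∧-elim {accepted (labels w) (suc (suc m))} h))

∑-allVecs-2 : ∀ k F → ∑ (allVecs 2 k) F ≡ ∑ (allFinL k) (λ x → ∑ (allFinL k) (λ y → F (x ∷ y ∷ [])))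
∑-allVecs-2 k F = trans (∑-allVecs-∷ 1 k F)
  (∑-cong (allFinL k) (λ x → trans (∑-allVecs-∷ 0 k _) (∑-cong (allFinL k) (λ y → +-identityʳ _))))

∑-allFin²-point : ∀ k a b c →
  ∑ (allFinL k) (λ x → ∑ (allFinL k) (λ y → 𝟙 (toℕ x ≡ᵇ a) * (𝟙 (toℕ y ≡ᵇ b) * c)))
    ≡ 𝟙 (a <ᵇ k) * (𝟙 (b <ᵇ k) * c)
∑-allFin²-point k a b c = trans
  (∑-cong (allFinL k) λ x →
    trans (∑-*ˡ (allFinL k) (𝟙 (toℕ x ≡ᵇ a)) _) (cong (𝟙 (toℕ x ≡ᵇ a) *_) (∑-allFin-point k b c)))
  (∑-allFin-point k a _)

𝟙-∧-true : ∀ b → 𝟙 (b ∧ true) ≡ 1 * (1 * 𝟙 b)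
𝟙-∧-true false = refl
𝟙-∧-true true  = refl

same-2 : ∀ {k} M (x y : Fin k) →
  same M (x ∷ y ∷ []) ≡ 𝟙 (toℕ x ≡ᵇ 0) * (𝟙 (toℕ y ≡ᵇ 0) * 𝟙 (1 ≡ᵇ M))
same-2 M x y with toℕ x | toℕ y
... | zero  | zero        = 𝟙-∧-true (1 ≡ᵇ M)
... | zero  | suc zero    = cong 𝟙 (∧-zeroʳ (2 ≡ᵇ M))
... | zero  | suc (suc _) = refl
... | suc _ | _           = refl

differ-2 : ∀ {k} M (x y : Fin k) →
  differ M (x ∷ y ∷ []) ≡ 𝟙 (toℕ x ≡ᵇ 0) * (𝟙 (toℕ y ≡ᵇ 1) * 𝟙 (2 ≡ᵇ M))
differ-2 M x y with toℕ x | toℕ y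
... | zero  | zero        = cong 𝟙 (∧-zeroʳ (1 ≡ᵇ M))
... | zero  | suc zero    = 𝟙-∧-true (2 ≡ᵇ M)
... | zero  | suc (suc _) = refl
... | suc _ | _           = refl

countSame-2 : ∀ k M → M ≤ k → countSame k 0 M ≡ top 0 M
countSame-2 k M M≤k = begin
    countSame k 0 M
  ≡⟨ ∑-allVecs-2 k (same M) ⟩
    ∑ (allFinL k) (λ x → ∑ (allFinL k) (λ y → same M (x ∷ y ∷ [])))
  ≡⟨ ∑-cong (allFinL k) (λ x → ∑-cong (allFinL k) (same-2 M x)) ⟩
    ∑ (allFinL k) (λ x → ∑ (allFinL k) (λ y → 𝟙 (toℕ x ≡ᵇ 0) * (𝟙 (toℕ y ≡ᵇ 0) * 𝟙 (1 ≡ᵇ M))))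
  ≡⟨ ∑-allFin²-point k 0 0 _ ⟩
    𝟙 (0 <ᵇ k) * (𝟙 (0 <ᵇ k) * 𝟙 (1 ≡ᵇ M))
  ≡⟨ evaluate k M M≤k ⟩
    top 0 M ∎
  where
  open ≡-Reasoning
  evaluate : ∀ k M → M ≤ k → 𝟙 (0 <ᵇ k) * (𝟙 (0 <ᵇ k) * 𝟙 (1 ≡ᵇ M)) ≡ top 0 M
  evaluate zero    zero          _ = refl
  evaluate (suc k) zero          _ = refl
  evaluate (suc k) (suc zero)    _ = refl
  evaluate (suc k) (suc (suc M)) _ = refl

countDiffer-2 : ∀ k M → M ≤ k → countDiffer k 0 M ≡ bottom 0 M
countDiffer-2 k M M≤k = begin
    countDiffer k 0 M
  ≡⟨ ∑-allVecs-2 k (differ M) ⟩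
    ∑ (allFinL k) (λ x → ∑ (allFinL k) (λ y → differ M (x ∷ y ∷ [])))
  ≡⟨ ∑-cong (allFinL k) (λ x → ∑-cong (allFinL k) (differ-2 M x)) ⟩
    ∑ (allFinL k) (λ x → ∑ (allFinL k) (λ y → 𝟙 (toℕ x ≡ᵇ 0) * (𝟙 (toℕ y ≡ᵇ 1) * 𝟙 (2 ≡ᵇ M))))
  ≡⟨ ∑-allFin²-point k 0 1 _ ⟩
    𝟙 (0 <ᵇ k) * (𝟙 (1 <ᵇ k) * 𝟙 (2 ≡ᵇ M))
  ≡⟨ evaluate k M M≤k ⟩
    bottom 0 M ∎
  where
  open ≡-Reasoning
  evaluate : ∀ k M → M ≤ k → 𝟙 (0 <ᵇ k) * (𝟙 (1 <ᵇ k) * 𝟙 (2 ≡ᵇ M)) ≡ bottom 0 M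
  evaluate zero          zero                _          = refl
  evaluate (suc zero)    zero                _          = refl
  evaluate (suc zero)    (suc zero)          _          = refl
  evaluate (suc zero)    (suc (suc M))       (s≤s ())
  evaluate (suc (suc k)) zero                _          = refl
  evaluate (suc (suc k)) (suc zero)          _          = refl
  evaluate (suc (suc k)) (suc (suc zero))    _          = refl
  evaluate (suc (suc k)) (suc (suc (suc M))) _          = refl

counts≡top×bottom : ∀ k m M → M ≤ k → countSame k m M ≡ top m M × countDiffer k m M ≡ bottom m M
counts≡top×bottom k zero    M M≤k = countSame-2 k M M≤k , countDiffer-2 k M M≤k
counts≡top×bottom k (suc m) M M≤k = same-count , differ-count M M≤k
  where
  open ≡-Reasoning
  same≡ : ∀ M → M ≤ k → countSame k m M ≡ top m M
  same≡ M M≤k = proj₁ (counts≡top×bottom k m M M≤k)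
  differ≡ : ∀ M → M ≤ k → countDiffer k m M ≡ bottom m M
  differ≡ M M≤k = proj₂ (counts≡top×bottom k m M M≤k)
  same-count : countSame k (suc m) M ≡ top (suc m) M
  same-count = begin
    countSame k (suc m) M                ≡⟨ countSame-suc k m M ⟩
    countSame k m M + countDiffer k m M  ≡⟨ cong₂ _+_ (same≡ M M≤k) (differ≡ M M≤k) ⟩
    top m M + bottom m M                 ≡⟨ top-suc m M ⟨
    top (suc m) M                        ∎
  differ-count : ∀ M → M ≤ k → countDiffer k (suc m) M ≡ bottom (suc m) M
  differ-count zero    _     = trans (countDiffer-suc-zero k m) (differ≡ 0 z≤n)
  differ-count (suc M) 1+M≤k = begin
    countDiffer k (suc m) (suc M)
      ≡⟨ countDiffer-suc-suc k m M 1+M≤k ⟩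
    countSame k m M + (countDiffer k m (suc M) + countDiffer k m M)
      ≡⟨ cong₂ _+_ (same≡ M M≤k′) (cong₂ _+_ (differ≡ (suc M) 1+M≤k) (differ≡ M M≤k′)) ⟩
    top m M + (bottom m (suc M) + bottom m M)
      ≡⟨ bottom-suc m (suc M) ⟨
    bottom (suc m) (suc M) ∎
    where M≤k′ = ≤-trans (n≤1+n M) 1+M≤k

theorem14 : (n : ℕ) → 2 ≤ n → (k : ℕ) → d k n ≡ coeff2 (genPoly n) n k
theorem14 (suc zero)    (s≤s ()) k
theorem14 (suc (suc m)) _        k = begin
    d k (suc (suc m))
  ≡⟨ length-filter isDivision (allVecs (suc (suc m)) k) ⟩
    ∑ (allVecs (suc (suc m)) k) (𝟙 ∘ isDivision)
  ≡⟨ ∑-cong (allVecs (suc (suc m)) k) (λ w → cong 𝟙 (isDivision≡acceptedWith w)) ⟩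
    ∑ (allVecs (suc (suc m)) k) (𝟙 ∘ acceptedWith k)
  ≡⟨ ∑-acceptedWith k m k ⟩
    countSame k m k + countDiffer k m k
  ≡⟨ cong₂ _+_ (proj₁ (counts≡top×bottom k m k ≤-refl)) (proj₂ (counts≡top×bottom k m k ≤-refl)) ⟩
    top m k + bottom m k
  ≡⟨ coeff-genPoly m k ⟨
    coeff2 (genPoly (suc (suc m))) (suc (suc m)) k ∎
  where open ≡-Reasoning
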